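{- Let $I=(G,s,t,\omega)$ be an instance of 2-SCSS-$(k,1)$ and let $I'$ be the associated token game described in the context. Then $\mathrm{OPT}(I)\le \mathrm{OPT}(I')$, where $\mathrm{OPT}(I)$ is the optimum cost of the 2-SCSS-$(k,1)$ instance and $\mathrm{OPT}(I')$ is the minimum cost of a sequence of moves from the state $s^{k+1}$ to the state $t^{k+1}$.
   Context: 2-SCSS-$(k,1)$: given a directed graph $G=(V,E)$ with weights $\omega:E\to\mathbb{R}_{\geq0}$, vertices $s,t$ and integer $k\geq1$, find directed $s\to t$ paths $F_1,\dots,F_k$ and a directed $t\to s$ path $B$ minimizing $\sum_{e\in E}\omega(e)\max\{|\{i:e\in F_i\}|,\ [e\in B]\}$. Associated token game $I'$: tokens $\mathsf{b},\mathsf{f}_1,\dots,\mathsf{f}_k$; states are vectors $\bar v=(v_0,v_1,\dots,v_k)\in V^{k+1}$ ($v_0$ is the position of $\mathsf{b}$, $v_i$ of $\mathsf{f}_i$); for $v\in V$, $v^{k+1}$ is the state with all tokens at $v$. From each state $\bar v$ the allowed moves are: (1) Backward: for every edge $(w,v_0)\in E$, replace $v_0$ by $w$, cost $\omega(w,v_0)$; (2) Forward: for every $i\in[k]$ and edge $(v_i,x)\in E$, replace $v_i$ by $x$, cost $\omega(v_i,x)$; (3) Flip: for every $i\in[k]$, swap coordinates $0$ and $i$, cost equal to the weight of a shortest directed $v_i\to v_0$ path in $G$. The cost of a move sequence is the sum of costs of its moves.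
   Formalization: The edge weights $\omega$ take values in the nonnegative rationals rather than in $\mathbb{R}_{\geq0}$. -}

module Defs where

open import Data.Nat as ℕ using (ℕ; zero; suc)
open import Data.Fin using (Fin; zero; suc; _≟_)
open import Data.Bool using (Bool; true; false; _∧_; _∨_; if_then_else_)
open import Data.List using (List; []; _∷_)
open import Data.List.Relation.Unary.Unique.Propositional using (Unique)
open import Data.Integer using (+_)
open import Data.Rational using (ℚ; 0ℚ; _+_; _*_; _≤_; _⊔_; _/_)
open import Data.Product using (Σ; _×_; _,_)
open import Relation.Binary.PropositionalEquality using (_≡_)
open import Relation.Nullary.Decidable using (⌊_⌋)

-- A weighted directed graph on the finite vertex set Fin n:
--   E u v ≡ true  iff  (u , v) is an edge;  ω u v is the weight of edge (u , v)
--   (ω is only relevant on edges).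
Adj : ℕ → Set
Adj n = Fin n → Fin n → Bool

Wt : ℕ → Set
Wt n = Fin n → Fin n → ℚ

ℕtoℚ : ℕ → ℚ
ℕtoℚ m = + m / 1

sumFin : (m : ℕ) → (Fin m → ℚ) → ℚ
sumFin zero    f = 0ℚ
sumFin (suc m) f = f zero + sumFin m (λ i → f (suc i))

countFin : (m : ℕ) → (Fin m → Bool) → ℕ
countFin zero    f = 0
countFin (suc m) f = (if f zero then 1 else 0) ℕ.+ countFin m (λ i → f (suc i))

-- Steps E u ws t : the vertex sequence u ∷ ws is a directed walk from u to t in E.
data Steps {n : ℕ} (E : Adj n) : Fin n → List (Fin n) → Fin n → Set where
  done : ∀ {v} → Steps E v [] v
  step : ∀ {u w ws t} → E u w ≡ true → Steps E w ws t → Steps E u (w ∷ ws) t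

record Path {n : ℕ} (E : Adj n) (s t : Fin n) : Set where
  constructor mkPath
  field
    rest   : List (Fin n)
    steps  : Steps E s rest t
    simple : Unique (s ∷ rest)
open Path public

usesFrom : {n : ℕ} → Fin n → List (Fin n) → Fin n → Fin n → Bool
usesFrom u []       a b = false
usesFrom u (w ∷ ws) a b = (⌊ u ≟ a ⌋ ∧ ⌊ w ≟ b ⌋) ∨ usesFrom w ws a b

uses : {n : ℕ} {E : Adj n} {s t : Fin n} → Path E s t → Fin n → Fin n → Bool
uses {s = s} P a b = usesFrom s (rest P) a b

weightFrom : {n : ℕ} → Wt n → Fin n → List (Fin n) → ℚ
weightFrom ω u []       = 0ℚ
weightFrom ω u (w ∷ ws) = ω u w + weightFrom ω w ws

pathWeight : {n : ℕ} {E : Adj n} {s t : Fin n} → Wt n → Path E s t → ℚ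
pathWeight {s = s} ω P = weightFrom ω s (rest P)

solCost : {n k : ℕ} (E : Adj n) (ω : Wt n) {s t : Fin n} →
          (Fin k → Path E s t) → Path E t s → ℚ
solCost {n} {k} E ω F B =
  sumFin n λ u → sumFin n λ v →
    if E u v
    then ω u v * (ℕtoℚ (countFin k (λ i → uses (F i) u v))
                   ⊔ ℕtoℚ (if uses B u v then 1 else 0))
    else 0ℚ

-- Token game states: position 0 is token b, position suc i is token f_{i+1}.
State : ℕ → ℕ → Set
State n k = Fin (suc k) → Fin n

setAt : {n k : ℕ} → State n k → Fin (suc k) → Fin n → State n k
setAt st j x i with ⌊ i ≟ j ⌋
... | true  = x
... | false = st i

swap0 : {n k : ℕ} → State n k → Fin k → State n k
swap0 st i zero = st (suc i)
swap0 st i (suc j) with ⌊ j ≟ i ⌋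
... | true  = st zero
... | false = st (suc j)

IsShortestDist : {n : ℕ} → Adj n → Wt n → Fin n → Fin n → ℚ → Set
IsShortestDist E ω u v c =
  Σ (Path E u v) λ P → (pathWeight ω P ≡ c) × ((Q : Path E u v) → c ≤ pathWeight ω Q)

data Move {n k : ℕ} (E : Adj n) (ω : Wt n) : State n k → State n k → ℚ → Set where
  backward : ∀ {st} w → E w (st zero) ≡ true →
             Move E ω st (setAt st zero w) (ω w (st zero))
  forward  : ∀ {st} (i : Fin k) x → E (st (suc i)) x ≡ true →
             Move E ω st (setAt st (suc i) x) (ω (st (suc i)) x)
  flip     : ∀ {st} (i : Fin k) c → IsShortestDist E ω (st (suc i)) (st zero) c →
             Move E ω st (swap0 st i) c

data Moves {n k : ℕ} (E : Adj n) (ω : Wt n) : State n k → State n k → ℚ → Set where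
  stop : ∀ {a b} → (∀ i → a i ≡ b i) → Moves E ω a b 0ℚ
  _∷_  : ∀ {a b d c c'} → Move E ω a b c → Moves E ω b d c' → Moves E ω a d (c + c')

allAt : {n k : ℕ} → Fin n → State n k
allAt v _ = v

{-# OPTIONS --safe #-}
module Submission where

-- Read a move sequence backwards.  If the tokens can get from a state v̄ to t^{k+1}
-- at cost c, there are walks W_j from v_j to t (the remaining route of f_j) and a walk
-- B from t to v_0 (the route of b, which moves against the edges) with
-- Σ_e ω(e) max(#{j : e ∈ W_j}, [e ∈ B]) ≤ c.  A forward or backward move extends one
-- walk by an edge; a flip of b and f_i extends both W_i and B by the same v_i → v_0
-- path P, which raises each maximum by at most [e ∈ P].  So no move raises the cost
-- by more than its price.  At s^{k+1}, loop erasure turns the walks into simple paths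
-- without increasing the cost.

open import Defs

import Algebra.Properties.CommutativeSemigroup as CommutativeSemigroupProperties
open import Algebra.Bundles using (CommutativeMonoid)
open import Data.Bool using (Bool; true; false; T; _∨_; _∧_; if_then_else_)
open import Data.Bool.Properties using (T-∨; ∨-assoc)
open import Data.Empty using (⊥-elim)
open import Data.Fin using (Fin; zero; suc; _≟_)
open import Data.Fin.Properties using (suc-injective)
open import Data.Integer as ℤ using (+_)
import Data.Integer.Properties as ℤ
open import Data.List using (List; []; _∷_; _++_)
open import Data.List.Membership.Propositional using (_∈_)
import Data.List.Membership.DecPropositional as DecMembership
open import Data.List.Relation.Unary.All using ([])
open import Data.List.Relation.Unary.All.Properties using (¬Any⇒All¬)
open import Data.List.Relation.Unary.AllPairs using ([]; _∷_)
open import Data.List.Relation.Unary.Any using (here; there)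
open import Data.Nat using (ℕ; zero; suc; _≥_)
import Data.Nat as ℕ
import Data.Nat.Coprimality as Coprimality
import Data.Nat.Properties as ℕ
open import Data.Product as Product using (Σ; _,_; proj₁; proj₂; _×_)
open import Data.Rational using (ℚ; 0ℚ; 1ℚ; mkℚ; *≤*; _≤_; _+_; _*_; _⊔_; toℚᵘ; nonNegative)
open import Data.Rational.Properties
  using ( normalize-coprime; toℚᵘ-injective; toℚᵘ-homo-+; ≤-refl; ≤-reflexive; ≤-trans
        ; +-mono-≤; +-comm; +-identityˡ; +-identityʳ; +-0-commutativeMonoid
        ; *-zeroʳ; *-identityʳ; *-distribˡ-+; *-monoˡ-≤-nonNeg; ⊔-lub; module ≤-Reasoning )
open import Data.Rational.Unnormalised as ℚᵘ using (mkℚᵘ; *≡*)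
import Data.Rational.Unnormalised.Properties as ℚᵘ
open import Data.Sum as Sum using (_⊎_; inj₂)
open import Function using (_∘_; id)
open import Function.Bundles using (Equivalence)
open import Relation.Binary.PropositionalEquality
open import Relation.Nullary using (¬_; yes; no)
open import Relation.Nullary.Decidable using (⌊_⌋)

module ℚ+ = CommutativeSemigroupProperties (CommutativeMonoid.commutativeSemigroup +-0-commutativeMonoid)
module ℕ+ = CommutativeSemigroupProperties ℕ.+-commutativeSemigroup

⊔-≤-+ : ∀ {x x′ y y′} s → x′ ℕ.≤ x ℕ.+ s → y′ ℕ.≤ y ℕ.+ s → x′ ℕ.⊔ y′ ℕ.≤ (x ℕ.⊔ y) ℕ.+ s
⊔-≤-+ {x} {y = y} s x′≤ y′≤ =
  ℕ.≤-trans (ℕ.⊔-mono-≤ x′≤ y′≤) (ℕ.≤-reflexive (sym (ℕ.+-distribʳ-⊔ s x y)))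

ind : Bool → ℕ
ind b = if b then 1 else 0

ind-mono : ∀ {x y} → (T x → T y) → ind x ℕ.≤ ind y
ind-mono {false}         _   = ℕ.z≤n
ind-mono {true}  {true}  _   = ℕ.≤-refl
ind-mono {true}  {false} x⇒y = ⊥-elim (x⇒y _)

ind-none : ∀ {x} → ¬ T x → ind x ≡ 0
ind-none {false} _  = refl
ind-none {true}  ¬x = ⊥-elim (¬x _)

ind-≤-+ : ∀ {x y z} → (T x → T y ⊎ T z) → ind x ℕ.≤ ind y ℕ.+ ind z
ind-≤-+ {false}                 _  = ℕ.z≤n
ind-≤-+ {true} {true}           _  = ℕ.s≤s ℕ.z≤n
ind-≤-+ {true} {false} {true}   _  = ℕ.≤-refl
ind-≤-+ {true} {false} {false} x⇒ = ⊥-elim (Sum.[ id , id ] (x⇒ _))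

ind-∨ : ∀ x y → ind (x ∨ y) ℕ.≤ ind x ℕ.+ ind y
ind-∨ x y = ind-≤-+ (Equivalence.to (T-∨ {x} {y}))

countFin-mono : ∀ k {f g : Fin k → Bool} → (∀ j → T (f j) → T (g j)) →
                countFin k f ℕ.≤ countFin k g
countFin-mono zero    _   = ℕ.z≤n
countFin-mono (suc k) f⇒g = ℕ.+-mono-≤ (ind-mono (f⇒g zero)) (countFin-mono k (f⇒g ∘ suc))

countFin-≤-+ : ∀ k {f g h : Fin k → Bool} → (∀ j → T (f j) → T (g j) ⊎ T (h j)) →
               countFin k f ℕ.≤ countFin k g ℕ.+ countFin k h
countFin-≤-+ zero    _  = ℕ.z≤n
countFin-≤-+ (suc k) {g = g} {h} f⇒ =
  ℕ.≤-trans (ℕ.+-mono-≤ (ind-≤-+ (f⇒ zero)) (countFin-≤-+ k (f⇒ ∘ suc)))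
            (ℕ.≤-reflexive (ℕ+.interchange (ind (g zero)) (ind (h zero))
                                           (countFin k (g ∘ suc)) (countFin k (h ∘ suc))))

countFin-none : ∀ k {f : Fin k → Bool} → (∀ j → ¬ T (f j)) → countFin k f ≡ 0
countFin-none zero    _  = refl
countFin-none (suc k) ¬f = cong₂ ℕ._+_ (ind-none (¬f zero)) (countFin-none k (¬f ∘ suc))

countFin-only : ∀ k {f : Fin k → Bool} {s} (i : Fin k) → (∀ j → T (f j) → j ≡ i × T s) →
                countFin k f ℕ.≤ ind s
countFin-only (suc k) {f} {s} zero f⇒ = begin
  ind (f zero) ℕ.+ countFin k (f ∘ suc)
    ≡⟨ cong (ind (f zero) ℕ.+_) (countFin-none k λ j → (λ ()) ∘ proj₁ ∘ f⇒ (suc j)) ⟩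
  ind (f zero) ℕ.+ 0
    ≡⟨ ℕ.+-identityʳ (ind (f zero)) ⟩
  ind (f zero)
    ≤⟨ ind-mono (proj₂ ∘ f⇒ zero) ⟩
  ind s
    ∎
  where open ℕ.≤-Reasoning
countFin-only (suc k) {f} {s} (suc i) f⇒ = begin
  ind (f zero) ℕ.+ countFin k (f ∘ suc)
    ≡⟨ cong (ℕ._+ countFin k (f ∘ suc)) (ind-none ((λ ()) ∘ proj₁ ∘ f⇒ zero)) ⟩
  countFin k (f ∘ suc)
    ≤⟨ countFin-only k i (λ j → Product.map₁ suc-injective ∘ f⇒ (suc j)) ⟩
  ind s
    ∎
  where open ℕ.≤-Reasoning

ℕtoℚ≡mkℚ : ∀ m → ℕtoℚ m ≡ mkℚ (+ m) 0 (Coprimality.sym (Coprimality.1-coprimeTo m))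
ℕtoℚ≡mkℚ m = normalize-coprime (Coprimality.sym (Coprimality.1-coprimeTo m))

ℕtoℚ-mono : ∀ {m n} → m ℕ.≤ n → ℕtoℚ m ≤ ℕtoℚ n
ℕtoℚ-mono {m} {n} m≤n rewrite ℕtoℚ≡mkℚ m | ℕtoℚ≡mkℚ n =
  *≤* (ℤ.*-monoʳ-≤-nonNeg (+ 1) (ℤ.+≤+ m≤n))

mkℚᵘ-+ : ∀ m n → mkℚᵘ (+ (m ℕ.+ n)) 0 ℚᵘ.≃ mkℚᵘ (+ m) 0 ℚᵘ.+ mkℚᵘ (+ n) 0
mkℚᵘ-+ m n = *≡* (begin
  + (m ℕ.+ n) ℤ.* + 1                    ≡⟨ ℤ.*-identityʳ _ ⟩
  + (m ℕ.+ n)                            ≡⟨ ℤ.pos-+ m n ⟩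
  + m ℤ.+ + n                            ≡⟨ cong₂ ℤ._+_ (ℤ.*-identityʳ (+ m)) (ℤ.*-identityʳ (+ n)) ⟨
  + m ℤ.* + 1 ℤ.+ + n ℤ.* + 1            ≡⟨ ℤ.*-identityʳ _ ⟨
  (+ m ℤ.* + 1 ℤ.+ + n ℤ.* + 1) ℤ.* + 1  ∎)
  where open ≡-Reasoning

ℕtoℚ-+ : ∀ m n → ℕtoℚ (m ℕ.+ n) ≡ ℕtoℚ m + ℕtoℚ n
ℕtoℚ-+ m n = toℚᵘ-injective (begin
  toℚᵘ (ℕtoℚ (m ℕ.+ n))                ≡⟨ toℚᵘ-ℕtoℚ (m ℕ.+ n) ⟩
  mkℚᵘ (+ (m ℕ.+ n)) 0                  ≈⟨ mkℚᵘ-+ m n ⟩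
  mkℚᵘ (+ m) 0 ℚᵘ.+ mkℚᵘ (+ n) 0       ≡⟨ cong₂ ℚᵘ._+_ (toℚᵘ-ℕtoℚ m) (toℚᵘ-ℕtoℚ n) ⟨
  toℚᵘ (ℕtoℚ m) ℚᵘ.+ toℚᵘ (ℕtoℚ n)     ≈⟨ toℚᵘ-homo-+ (ℕtoℚ m) (ℕtoℚ n) ⟨
  toℚᵘ (ℕtoℚ m + ℕtoℚ n)                ∎)
  where
  open ℚᵘ.≃-Reasoning
  toℚᵘ-ℕtoℚ : ∀ m → toℚᵘ (ℕtoℚ m) ≡ mkℚᵘ (+ m) 0
  toℚᵘ-ℕtoℚ m = cong toℚᵘ (ℕtoℚ≡mkℚ m)

ℕtoℚ-mono-+ : ∀ {m} n p → m ℕ.≤ n ℕ.+ p → ℕtoℚ m ≤ ℕtoℚ n + ℕtoℚ p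
ℕtoℚ-mono-+ n p m≤n+p = ≤-trans (ℕtoℚ-mono m≤n+p) (≤-reflexive (ℕtoℚ-+ n p))

ℕtoℚ-⊔-mono : ∀ {m m′ n n′} → m ℕ.≤ m′ → n ℕ.≤ n′ → ℕtoℚ m ⊔ ℕtoℚ n ≤ ℕtoℚ (m′ ℕ.⊔ n′)
ℕtoℚ-⊔-mono {m′ = m′} {n′ = n′} m≤m′ n≤n′ =
  ⊔-lub (ℕtoℚ-mono (ℕ.≤-trans m≤m′ (ℕ.m≤m⊔n m′ n′)))
        (ℕtoℚ-mono (ℕ.≤-trans n≤n′ (ℕ.m≤n⊔m m′ n′)))

sumFin-cong : ∀ m {f g : Fin m → ℚ} → (∀ i → f i ≡ g i) → sumFin m f ≡ sumFin m g
sumFin-cong zero    _   = refl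
sumFin-cong (suc m) f≡g = cong₂ _+_ (f≡g zero) (sumFin-cong m (f≡g ∘ suc))

sumFin-mono : ∀ m {f g : Fin m → ℚ} → (∀ i → f i ≤ g i) → sumFin m f ≤ sumFin m g
sumFin-mono zero    _   = ≤-refl
sumFin-mono (suc m) f≤g = +-mono-≤ (f≤g zero) (sumFin-mono m (f≤g ∘ suc))

sumFin-+ : ∀ m (f g : Fin m → ℚ) → sumFin m (λ i → f i + g i) ≡ sumFin m f + sumFin m g
sumFin-+ zero    f g = sym (+-identityʳ 0ℚ)
sumFin-+ (suc m) f g =
  trans (cong (_+_ (f zero + g zero)) (sumFin-+ m (f ∘ suc) (g ∘ suc)))
        (ℚ+.interchange (f zero) (g zero) (sumFin m (f ∘ suc)) (sumFin m (g ∘ suc)))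

sumFin-zero : ∀ m {f : Fin m → ℚ} → (∀ i → f i ≡ 0ℚ) → sumFin m f ≡ 0ℚ
sumFin-zero zero    _   = refl
sumFin-zero (suc m) f≡0 = cong₂ _+_ (f≡0 zero) (sumFin-zero m (f≡0 ∘ suc))

sumFin-single : ∀ m {f : Fin m → ℚ} (u : Fin m) → (∀ i → i ≢ u → f i ≡ 0ℚ) → sumFin m f ≡ f u
sumFin-single (suc m) {f} zero    f≡0 =
  trans (cong (_+_ (f zero)) (sumFin-zero m (λ i → f≡0 (suc i) λ ()))) (+-identityʳ (f zero))
sumFin-single (suc m) {f} (suc u) f≡0 =
  trans (cong₂ _+_ (f≡0 zero λ ())
                   (sumFin-single m u λ i i≢u → f≡0 (suc i) (i≢u ∘ suc-injective)))
        (+-identityˡ (f (suc u)))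

EdgeSet : ℕ → Set
EdgeSet n = Fin n → Fin n → Bool

_⊆ₑ_ : ∀ {n} → EdgeSet n → EdgeSet n → Set
U ⊆ₑ V = ∀ a b → T (U a b) → T (V a b)

singleEdge : ∀ {n} → Fin n → Fin n → EdgeSet n
singleEdge u w a b = ⌊ u ≟ a ⌋ ∧ ⌊ w ≟ b ⌋

singleEdge-self : ∀ {n} (u w : Fin n) → singleEdge u w u w ≡ true
singleEdge-self u w with u ≟ u | w ≟ w
... | yes _ | yes _ = refl
... | yes _ | no w≢w = ⊥-elim (w≢w refl)
... | no u≢u | _    = ⊥-elim (u≢u refl)

singleEdge-other : ∀ {n} {u w a b : Fin n} → ¬ (a ≡ u × b ≡ w) → singleEdge u w a b ≡ false
singleEdge-other {u = u} {w} {a} {b} ≢uw with u ≟ a | w ≟ b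
... | yes u≡a | yes w≡b = ⊥-elim (≢uw (sym u≡a , sym w≡b))
... | yes _   | no _    = refl
... | no _    | _       = refl

T-∨-introʳ : ∀ x {y} → T y → T (x ∨ y)
T-∨-introʳ x = Equivalence.from (T-∨ {x}) ∘ inj₂

T-∨-monoʳ : ∀ x {y z} → (T y → T z) → T (x ∨ y) → T (x ∨ z)
T-∨-monoʳ x {y} y⇒z = Equivalence.from (T-∨ {x}) ∘ Sum.map₂ y⇒z ∘ Equivalence.to (T-∨ {x} {y})

module _ {n : ℕ} (E : Adj n) where

  record Walk (u v : Fin n) : Set where
    constructor walk
    field
      route : List (Fin n)
      along : Steps E u route v
  open Walk public

module _ {n : ℕ} {E : Adj n} where

  walkUses : ∀ {u v} → Walk E u v → EdgeSet n
  walkUses {u} W = usesFrom u (route W)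

  stay : ∀ {u} → Walk E u u
  stay = walk [] done

  edgeWalk : ∀ {u w} → E u w ≡ true → Walk E u w
  edgeWalk e = walk _ (step e done)

  pathWalk : ∀ {u v} → Path E u v → Walk E u v
  pathWalk P = walk (rest P) (steps P)

  -- Unlike subst, cast keeps the route, so walkUses (cast p W) is walkUses W by definition.
  cast : ∀ {u v v′} → v ≡ v′ → Walk E u v → Walk E u v′
  cast v≡v′ (walk r s) = walk r (subst (Steps E _ r) v≡v′ s)

  steps-++ : ∀ {u m v r r′} → Steps E u r m → Steps E m r′ v → Steps E u (r ++ r′) v
  steps-++ done       s′ = s′
  steps-++ (step e s) s′ = step e (steps-++ s s′)

  _++ʷ_ : ∀ {u m v} → Walk E u m → Walk E m v → Walk E u v
  walk r s ++ʷ walk r′ s′ = walk (r ++ r′) (steps-++ s s′)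

  usesFrom-++ : ∀ {u m r} → Steps E u r m → ∀ r′ a b →
                usesFrom u (r ++ r′) a b ≡ usesFrom u r a b ∨ usesFrom m r′ a b
  usesFrom-++ done                      r′ a b = refl
  usesFrom-++ {u} {m} (step {w = w} {ws = r} _ s) r′ a b = begin
    singleEdge u w a b ∨ usesFrom w (r ++ r′) a b
      ≡⟨ cong (singleEdge u w a b ∨_) (usesFrom-++ s r′ a b) ⟩
    singleEdge u w a b ∨ (usesFrom w r a b ∨ usesFrom m r′ a b)
      ≡⟨ ∨-assoc (singleEdge u w a b) (usesFrom w r a b) (usesFrom m r′ a b) ⟨
    (singleEdge u w a b ∨ usesFrom w r a b) ∨ usesFrom m r′ a b
      ∎
    where open ≡-Reasoning

  walkUses-++ : ∀ {u m v} (W : Walk E u m) (W′ : Walk E m v) a b →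
                T (walkUses (W ++ʷ W′) a b) → T (walkUses W a b) ⊎ T (walkUses W′ a b)
  walkUses-++ (walk r s) (walk r′ _) a b =
    Equivalence.to T-∨ ∘ subst T (usesFrom-++ s r′ a b)

  dropUntil : ∀ {u w v} (P : Path E w v) → u ∈ (w ∷ rest P) →
              Σ (Path E u v) λ Q → uses Q ⊆ₑ uses P
  dropUntil P (here refl) = P , λ _ _ → id
  dropUntil (mkPath [] _ _) (there ())
  dropUntil (mkPath (x ∷ r) (step _ s) (_ ∷ unique)) (there u∈) =
    let Q , Q⊆ = dropUntil (mkPath r s unique) u∈ in Q , λ a b → T-∨-introʳ _ ∘ Q⊆ a b

  loopErase : ∀ {u v} (W : Walk E u v) → Σ (Path E u v) λ P → uses P ⊆ₑ walkUses W
  loopErase (walk [] done) = mkPath [] done ([] ∷ []) , λ _ _ ()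
  loopErase {u} (walk (w ∷ r) (step e s)) with loopErase (walk r s)
  ... | P , P⊆ with DecMembership._∈?_ _≟_ u (w ∷ rest P)
  -- u already lies on P, so the walk closed a cycle at u: cut it off.
  ...   | yes u∈P = let Q , Q⊆ = dropUntil P u∈P in
                    Q , λ a b → T-∨-introʳ _ ∘ P⊆ a b ∘ Q⊆ a b
  ...   | no u∉P  = mkPath (w ∷ rest P) (step e (steps P)) (¬Any⇒All¬ _ u∉P ∷ simple P) ,
                    λ a b → T-∨-monoʳ _ (P⊆ a b)

module _ {n : ℕ} (E : Adj n) (ω : Wt n) where

  -- solCost E ω F B unfolds to an edgeSum.
  edgeSum : (Fin n → Fin n → ℚ) → ℚ
  edgeSum q = sumFin n λ a → sumFin n λ b → if E a b then ω a b * q a b else 0ℚ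

  setWeight : EdgeSet n → ℚ
  setWeight U = edgeSum λ a b → ℕtoℚ (ind (U a b))

  walkWeight : ∀ {u v} → Walk E u v → ℚ
  walkWeight {u} W = weightFrom ω u (route W)

  edgeSum-mono : (∀ u v → 0ℚ ≤ ω u v) → ∀ {q r} → (∀ a b → q a b ≤ r a b) →
                 edgeSum q ≤ edgeSum r
  edgeSum-mono ω≥0 {q} {r} q≤r = sumFin-mono n λ a → sumFin-mono n λ b → term a b
    where
    term : ∀ a b → (if E a b then ω a b * q a b else 0ℚ)
                 ≤ (if E a b then ω a b * r a b else 0ℚ)
    term a b with E a b
    ... | true  = *-monoˡ-≤-nonNeg (ω a b) {{nonNegative (ω≥0 a b)}} (q≤r a b)
    ... | false = ≤-refl

  edgeSum-+ : ∀ q r → edgeSum (λ a b → q a b + r a b) ≡ edgeSum q + edgeSum r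
  edgeSum-+ q r =
    trans (sumFin-cong n λ a → trans (sumFin-cong n (term a)) (sumFin-+ n _ _)) (sumFin-+ n _ _)
    where
    term : ∀ a b → (if E a b then ω a b * (q a b + r a b) else 0ℚ)
                 ≡ (if E a b then ω a b * q a b else 0ℚ) + (if E a b then ω a b * r a b else 0ℚ)
    term a b with E a b
    ... | true  = *-distribˡ-+ (ω a b) (q a b) (r a b)
    ... | false = sym (+-identityʳ 0ℚ)

  edgeTerm-zero : ∀ {a b x} → x ≡ 0ℚ → (if E a b then ω a b * x else 0ℚ) ≡ 0ℚ
  edgeTerm-zero {a} {b} refl with E a b
  ... | true  = *-zeroʳ (ω a b)
  ... | false = refl

  edgeSum-zero : ∀ {q} → (∀ a b → q a b ≡ 0ℚ) → edgeSum q ≡ 0ℚ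
  edgeSum-zero q≡0 = sumFin-zero n λ a → sumFin-zero n λ b → edgeTerm-zero (q≡0 a b)

  setWeight-singleEdge : ∀ {u w} → E u w ≡ true → setWeight (singleEdge u w) ≡ ω u w
  setWeight-singleEdge {u} {w} e = begin
    setWeight (singleEdge u w)
      ≡⟨ sumFin-single n u (λ a a≢u → sumFin-zero n λ b → off (a≢u ∘ proj₁)) ⟩
    sumFin n (term u)
      ≡⟨ sumFin-single n w (λ b b≢w → off (b≢w ∘ proj₂)) ⟩
    term u w
      ≡⟨ cong₂ (λ x y → if x then ω u w * ℕtoℚ (ind y) else 0ℚ) e (singleEdge-self u w) ⟩
    ω u w * 1ℚ
      ≡⟨ *-identityʳ (ω u w) ⟩
    ω u w
      ∎
    where
    open ≡-Reasoning
    term : Fin n → Fin n → ℚ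
    term a b = if E a b then ω a b * ℕtoℚ (ind (singleEdge u w a b)) else 0ℚ
    off : ∀ {a b} → ¬ (a ≡ u × b ≡ w) → term a b ≡ 0ℚ
    off ≢uw = edgeTerm-zero (cong (ℕtoℚ ∘ ind) (singleEdge-other ≢uw))

  setWeight-walk : (∀ u v → 0ℚ ≤ ω u v) → ∀ {u v} (W : Walk E u v) →
                   setWeight (walkUses W) ≤ walkWeight W
  setWeight-walk ω≥0 (walk [] done) = ≤-reflexive (edgeSum-zero λ _ _ → refl)
  setWeight-walk ω≥0 {u} (walk (w ∷ r) (step e s)) = begin
    setWeight (λ a b → singleEdge u w a b ∨ usesFrom w r a b)
      ≤⟨ edgeSum-mono ω≥0 (λ a b → ℕtoℚ-mono-+ (ind (singleEdge u w a b)) (ind (usesFrom w r a b))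
                                       (ind-∨ (singleEdge u w a b) (usesFrom w r a b))) ⟩
    edgeSum (λ a b → ℕtoℚ (ind (singleEdge u w a b)) + ℕtoℚ (ind (usesFrom w r a b)))
      ≡⟨ edgeSum-+ _ _ ⟩
    setWeight (singleEdge u w) + setWeight (usesFrom w r)
      ≤⟨ +-mono-≤ (≤-reflexive (setWeight-singleEdge e)) (setWeight-walk ω≥0 (walk r s)) ⟩
    ω u w + weightFrom ω w r
      ∎
    where open ≤-Reasoning

setAt-eq : ∀ {n k} (st : State n k) j x → setAt st j x j ≡ x
setAt-eq st j x with j ≟ j
... | yes _  = refl
... | no j≢j = ⊥-elim (j≢j refl)

setAt-neq : ∀ {n k} (st : State n k) j x {j′} → j′ ≢ j → setAt st j x j′ ≡ st j′
setAt-neq st j x {j′} j′≢j with j′ ≟ j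
... | yes j′≡j = ⊥-elim (j′≢j j′≡j)
... | no _     = refl

swap0-eq : ∀ {n k} (st : State n k) i → swap0 st i (suc i) ≡ st zero
swap0-eq st i with i ≟ i
... | yes _  = refl
... | no i≢i = ⊥-elim (i≢i refl)

swap0-neq : ∀ {n k} (st : State n k) i {j} → j ≢ i → swap0 st i (suc j) ≡ st (suc j)
swap0-neq st i {j} j≢i with j ≟ i
... | yes j≡i = ⊥-elim (j≢i j≡i)
... | no _    = refl

module TokenGame {n : ℕ} (E : Adj n) (ω : Wt n) (ω≥0 : ∀ u v → 0ℚ ≤ ω u v)
                 {k : ℕ} (t : Fin n) where

  load : (Fin k → EdgeSet n) → EdgeSet n → Fin n → Fin n → ℕ
  load F B a b = countFin k (λ j → F j a b) ℕ.⊔ ind (B a b)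

  loadCost : (Fin k → EdgeSet n) → EdgeSet n → ℚ
  loadCost F B = edgeSum E ω λ a b → ℕtoℚ (load F B a b)

  record Completion (st : State n k) (c : ℚ) : Set where
    constructor mkCompletion
    field
      forwardWalk  : (j : Fin k) → Walk E (st (suc j)) t
      backwardWalk : Walk E t (st zero)
      cost≤        : loadCost (λ j → walkUses (forwardWalk j)) (walkUses backwardWalk) ≤ c

  finished : ∀ {st} → (∀ j → st j ≡ t) → Completion st 0ℚ
  finished at-t = mkCompletion (λ j → cast (at-t (suc j)) stay) (cast (sym (at-t zero)) stay)
    (≤-reflexive (edgeSum-zero E ω λ _ _ → cong (λ m → ℕtoℚ (m ℕ.⊔ 0)) (countFin-none k λ _ ())))

  -- Each edge gains at most one unit of load, and only if it lies on S.
  extend : ∀ {st st′ : State n k} {c m p q} (S : Walk E p q) → walkWeight E ω S ≤ m →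
           (C : ∀ j → Walk E (st (suc j)) (st′ (suc j))) →
           (∀ a b → countFin k (λ j → walkUses (C j) a b) ℕ.≤ ind (walkUses S a b)) →
           (Cb : Walk E (st′ zero) (st zero)) → walkUses Cb ⊆ₑ walkUses S →
           Completion st′ c → Completion st (m + c)
  extend {c = c} {m} S S≤m C C≤S Cb Cb⊆S (mkCompletion F B cost≤) =
    mkCompletion (λ j → C j ++ʷ F j) (B ++ʷ Cb) (begin
      loadCost F′-uses B′-uses
        ≤⟨ edgeSum-mono E ω ω≥0 (λ a b →
             ℕtoℚ-mono-+ (load F-uses B-uses a b) (ind (S-uses a b)) (load≤ a b)) ⟩
      edgeSum E ω (λ a b → ℕtoℚ (load F-uses B-uses a b) + ℕtoℚ (ind (S-uses a b)))
        ≡⟨ edgeSum-+ E ω _ _ ⟩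
      loadCost F-uses B-uses + setWeight E ω S-uses
        ≤⟨ +-mono-≤ cost≤ (≤-trans (setWeight-walk E ω ω≥0 S) S≤m) ⟩
      c + m
        ≡⟨ +-comm c m ⟩
      m + c
        ∎)
    where
    open ≤-Reasoning
    F-uses F′-uses : Fin k → EdgeSet n
    F-uses  j = walkUses (F j)
    F′-uses j = walkUses (C j ++ʷ F j)
    B-uses B′-uses S-uses : EdgeSet n
    B-uses  = walkUses B
    B′-uses = walkUses (B ++ʷ Cb)
    S-uses  = walkUses S
    load≤ : ∀ a b → load F′-uses B′-uses a b ℕ.≤ load F-uses B-uses a b ℕ.+ ind (S-uses a b)
    load≤ a b = ⊔-≤-+ (ind (S-uses a b))
      (ℕ.≤-trans (countFin-≤-+ k {λ j → F′-uses j a b} {λ j → F-uses j a b} {λ j → walkUses (C j) a b}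
                                (λ j → Sum.swap ∘ walkUses-++ (C j) (F j) a b))
                 (ℕ.+-monoʳ-≤ (countFin k (λ j → F-uses j a b)) (C≤S a b)))
      (ℕ.≤-trans (ind-≤-+ (walkUses-++ B Cb a b))
                 (ℕ.+-monoʳ-≤ (ind (B-uses a b)) (ind-mono (Cb⊆S a b))))

  connectAt : ∀ {st st′ : State n k} (i : Fin k) → Walk E (st (suc i)) (st′ (suc i)) →
              (∀ {j} → j ≢ i → st (suc j) ≡ st′ (suc j)) → ∀ j → Walk E (st (suc j)) (st′ (suc j))
  connectAt i C same j with j ≟ i
  ... | yes refl = C
  ... | no j≢i   = cast (same j≢i) stay

  connectAt-count : ∀ {st st′ : State n k} i (C : Walk E (st (suc i)) (st′ (suc i)))
                    (same : ∀ {j} → j ≢ i → st (suc j) ≡ st′ (suc j)) a b →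
                    countFin k (λ j → walkUses (connectAt i C same j) a b) ℕ.≤ ind (walkUses C a b)
  connectAt-count {st} {st′} i C same a b = countFin-only k i only
    where
    only : ∀ j → T (walkUses (connectAt {st} {st′} i C same j) a b) → j ≡ i × T (walkUses C a b)
    only j with j ≟ i
    ... | yes refl = refl ,_
    ... | no _     = λ ()

  completion-backward : ∀ {st c w} → E w (st zero) ≡ true →
                        Completion (setAt st zero w) c → Completion st (ω w (st zero) + c)
  completion-backward {st} {w = w} e =
    extend {st} {setAt st zero w} S (≤-reflexive (+-identityʳ (ω w (st zero))))
      (λ _ → stay) (λ _ _ → ℕ.≤-trans (ℕ.≤-reflexive (countFin-none k λ _ ())) ℕ.z≤n)
      S (λ _ _ → id)
    where S = edgeWalk e

  completion-forward : ∀ {st c} i x → E (st (suc i)) x ≡ true →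
                       Completion (setAt st (suc i) x) c → Completion st (ω (st (suc i)) x + c)
  completion-forward {st} i x e =
    extend {st} {st′} S (≤-reflexive (+-identityʳ (ω (st (suc i)) x)))
      (connectAt {st} {st′} i S′ same) (connectAt-count {st} {st′} i S′ same)
      stay (λ _ _ ())
    where
    st′ = setAt st (suc i) x
    S  = edgeWalk e
    S′ = cast (sym (setAt-eq st (suc i) x)) S
    same : ∀ {j} → j ≢ i → st (suc j) ≡ st′ (suc j)
    same j≢i = sym (setAt-neq st (suc i) x (j≢i ∘ suc-injective))

  completion-flip : ∀ {st c m} i (P : Path E (st (suc i)) (st zero)) → pathWeight ω P ≡ m →
                    Completion (swap0 st i) c → Completion st (m + c)
  completion-flip {st} i P weight≡m =
    extend {st} {st′} S (≤-reflexive weight≡m)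
      (connectAt {st} {st′} i S′ same) (connectAt-count {st} {st′} i S′ same)
      S (λ _ _ → id)
    where
    st′ = swap0 st i
    S  = pathWalk P
    S′ = cast (sym (swap0-eq st i)) S
    same : ∀ {j} → j ≢ i → st (suc j) ≡ st′ (suc j)
    same j≢i = sym (swap0-neq st i j≢i)

  moves⇒completion : ∀ {st c} → Moves E ω st (allAt t) c → Completion st c
  moves⇒completion (stop at-t)              = finished at-t
  moves⇒completion (backward _ e ∷ ms)      = completion-backward e (moves⇒completion ms)
  moves⇒completion (forward i x e ∷ ms)     = completion-forward i x e (moves⇒completion ms)
  moves⇒completion (flip i _ (P , w≡m , _) ∷ ms) = completion-flip i P w≡m (moves⇒completion ms)

  completion⇒solution : ∀ {s c} → Completion (allAt s) c →
                        Σ (Fin k → Path E s t) λ F → Σ (Path E t s) λ B → solCost E ω F B ≤ c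
  completion⇒solution (mkCompletion W B cost≤) = F , B′ , ≤-trans
    (edgeSum-mono E ω ω≥0 λ a b →
      ℕtoℚ-⊔-mono (countFin-mono k λ j → proj₂ (loopErase (W j)) a b)
                  (ind-mono (proj₂ (loopErase B) a b)))
    cost≤
    where
    F  = λ j → proj₁ (loopErase (W j))
    B′ = proj₁ (loopErase B)

lemma5 : (n : ℕ) (E : Adj n) (ω : Wt n) → (∀ u v → 0ℚ ≤ ω u v) →
    (s t : Fin n) (k : ℕ) → k ≥ 1 →
    (c : ℚ) → Moves {n} {k} E ω (allAt s) (allAt t) c →
    Σ (Fin k → Path E s t) λ F → Σ (Path E t s) λ B → solCost E ω F B ≤ c
lemma5 n E ω ω≥0 s t k _ c moves = completion⇒solution (moves⇒completion moves)
  where open TokenGame E ω ω≥0 {k} t
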